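{- Let $G$ be a $(P_5,\textit{HVN})$-free graph containing an induced $T$-5-wheel $\Sigma$, with the notation below. Then every vertex of $V(G)\setminus S$ that has a neighbour in $S$ belongs to $Y_2\cup Y_5\cup Y_{1,x}\cup P^3\cup P^{3,x}\cup T$.
   Context: Graphs are finite, simple and connected. $P_5$ is the path on 5 vertices; an HVN is a $K_4$ plus a vertex adjacent to exactly two vertices of the $K_4$; $(H_1,H_2)$-free means no induced $H_1$ or $H_2$. A $T$-5-wheel is an induced cycle $C=v_1v_2v_3v_4v_5v_1$ together with a vertex $x$ adjacent to exactly $v_1,v_2,v_5$ on $C$; here $\Sigma$ is such an induced subgraph of $G$. Indices are modulo 5. For $u\in V(G)$, $N_C(u)$ and $N_\Sigma(u)$ denote the sets of neighbours of $u$ in $V(C)$ and $V(\Sigma)$. For $i\in\{1,\dots,5\}$, among vertices $u$ with $ux\notin E(G)$: $Y_i=\{u: N_C(u)=\{v_{i-2},v_i,v_{i+2}\}\}$, $P^i=\{u: N_C(u)=\{v_{i-1},v_i,v_{i+1},v_{i+2}\}\}$, $T=\{u: N_C(u)=V(C)\}$. Further $S=\{u: N_\Sigma(u)=\emptyset\}$, $Y_{i,x}=\{u: N_\Sigma(u)=\{v_{i-2},v_i,v_{i+2},x\}\}$, $P^{i,x}=\{u:N_\Sigma(u)=\{v_{i-1},v_i,v_{i+1},v_{i+2},x\}\}$. -}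

module Defs where

open import Data.Nat using (ℕ; zero; suc; _+_; _<ᵇ_; _≡ᵇ_; _%_)
open import Data.Nat.DivMod using (_mod_)
open import Data.Bool using (Bool; true; false; _∧_; _∨_; not)
open import Data.Fin using (Fin; toℕ; inject₁; fromℕ)
open import Data.Product using (Σ; _×_; ∃; ∃-syntax)
open import Data.Sum using (_⊎_)
open import Relation.Nullary using (¬_)
open import Relation.Binary.PropositionalEquality using (_≡_)
open import Function.Definitions using (Injective)

data Reach {n : ℕ} (adj : Fin n → Fin n → Bool) : Fin n → Fin n → Set where
  here : ∀ {u} → Reach adj u u
  step : ∀ {u w v} → adj u w ≡ true → Reach adj w v → Reach adj u v

record Graph : Set where
  field
    n         : ℕ
    adj       : Fin n → Fin n → Bool
    sym       : ∀ u v → adj u v ≡ adj v u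
    irrefl    : ∀ u → adj u u ≡ false
    connected : ∀ u v → Reach adj u v

open Graph public

record InducedCopy {k : ℕ} (adjH : Fin k → Fin k → Bool) (G : Graph) : Set where
  field
    f     : Fin k → Fin (n G)
    inj   : Injective _≡_ _≡_ f
    edges : ∀ i j → adj G (f i) (f j) ≡ adjH i j

open InducedCopy public

Free : ∀ {k} → (Fin k → Fin k → Bool) → Graph → Set
Free adjH G = ¬ InducedCopy adjH G

adjP5 : Fin 5 → Fin 5 → Bool
adjP5 i j = ((suc (toℕ i)) ≡ᵇ toℕ j) ∨ ((suc (toℕ j)) ≡ᵇ toℕ i)

hvnℕ : ℕ → ℕ → Bool
hvnℕ a b = not (a ≡ᵇ b) ∧ (((a <ᵇ 4) ∧ (b <ᵇ 4))
                          ∨ ((a ≡ᵇ 4) ∧ (b <ᵇ 2))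
                          ∨ ((b ≡ᵇ 4) ∧ (a <ᵇ 2)))

adjHVN : Fin 5 → Fin 5 → Bool
adjHVN i j = hvnℕ (toℕ i) (toℕ j)

-- T-5-wheel on Fin 6: positions 0..4 form the induced 5-cycle, where
-- position (k mod 5) is the paper's v_k (so v_1..v_4 = positions 1..4
-- and v_5 = position 0); position 5 is x, adjacent exactly to
-- v_1, v_2, v_5, i.e. positions 1, 2, 0.
cycℕ : ℕ → ℕ → Bool
cycℕ a b = (a <ᵇ 5) ∧ (b <ᵇ 5) ∧ ((((a + 1) % 5) ≡ᵇ b) ∨ (((b + 1) % 5) ≡ᵇ a))

hubℕ : ℕ → ℕ → Bool
hubℕ a b = (a ≡ᵇ 5) ∧ (b <ᵇ 3)

adjW : Fin 6 → Fin 6 → Bool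
adjW i j = cycℕ (toℕ i) (toℕ j) ∨ hubℕ (toℕ i) (toℕ j) ∨ hubℕ (toℕ j) (toℕ i)

module Wheel (G : Graph) (σ : InducedCopy adjW G) where

  V : Set
  V = Fin (n G)

  v : ℕ → V
  v k = f σ (inject₁ (k mod 5))

  x : V
  x = f σ (fromℕ 5)

  _~_ : V → V → Set
  a ~ b = adj G a b ≡ true

  _≁_ : V → V → Set
  a ≁ b = adj G a b ≡ false

  NC3 : V → ℕ → ℕ → ℕ → Set
  NC3 u a b c = ∀ k → (u ~ v k → ((k mod 5) ≡ (a mod 5)) ⊎ ((k mod 5) ≡ (b mod 5)) ⊎ ((k mod 5) ≡ (c mod 5)))
                    × ((((k mod 5) ≡ (a mod 5)) ⊎ ((k mod 5) ≡ (b mod 5)) ⊎ ((k mod 5) ≡ (c mod 5))) → u ~ v k)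

  NC4 : V → ℕ → ℕ → ℕ → ℕ → Set
  NC4 u a b c d = ∀ k → (u ~ v k → ((k mod 5) ≡ (a mod 5)) ⊎ ((k mod 5) ≡ (b mod 5)) ⊎ ((k mod 5) ≡ (c mod 5)) ⊎ ((k mod 5) ≡ (d mod 5)))
                    × ((((k mod 5) ≡ (a mod 5)) ⊎ ((k mod 5) ≡ (b mod 5)) ⊎ ((k mod 5) ≡ (c mod 5)) ⊎ ((k mod 5) ≡ (d mod 5))) → u ~ v k)

  -- Indices i-2, i-1 are written i+3, i+4 (mod 5).
  Y : ℕ → V → Set
  Y i u = (u ≁ x) × NC3 u (i + 3) i (i + 2)

  P : ℕ → V → Set
  P i u = (u ≁ x) × NC4 u (i + 4) i (i + 1) (i + 2)

  T : V → Set
  T u = (u ≁ x) × (∀ k → u ~ v k)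

  S : V → Set
  S u = (u ≁ x) × (∀ k → u ≁ v k)

  Yx : ℕ → V → Set
  Yx i u = (u ~ x) × NC3 u (i + 3) i (i + 2)

  Px : ℕ → V → Set
  Px i u = (u ~ x) × NC4 u (i + 4) i (i + 1) (i + 2)

-- Let s ∈ S be a neighbour of u. The subgraph induced on V(Σ) ∪ {u, s} is
-- determined by which of the six vertices of Σ are adjacent to u. For each of
-- the 64 possibilities, either u lies in S or in one of the six classes of the
-- conclusion, or five of these eight vertices induce a P₅ or an HVN. The table
-- `verdict` names such five vertices and each entry is checked by evaluation;
-- an entry with wildcards covers several profiles at once, which works because
-- its witness avoids the unconstrained positions.
module Submission where

open import Defs
open import Data.Bool using (Bool; true; false)
open import Data.Bool.Properties using () renaming (_≟_ to _≟ᵇ_)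
open import Data.Empty using (⊥; ⊥-elim)
open import Data.Fin using (Fin; zero; suc; inject₁; splitAt; join; #_)
open import Data.Fin.Properties using (_≟_; all?; any?; join-splitAt)
open import Data.Nat using (ℕ)
open import Data.Nat.DivMod using (_mod_)
open import Data.Product using (_×_; ∃-syntax; _,_; proj₁; proj₂)
open import Data.Sum using (_⊎_; inj₁; inj₂)
open import Data.Unit using (tt)
open import Data.Vec using (Vec; []; _∷_; lookup; tabulate; replicate)
open import Data.Vec.Properties using (lookup∘tabulate; lookup-replicate)
open import Function using (_∘_)
open import Relation.Nullary using (¬_; Dec; yes; no; does)
open import Relation.Nullary.Decidable using (True; toWitness; from-yes; _×-dec_; _⊎-dec_; _→-dec_)
open import Relation.Binary.PropositionalEquality as ≡ using (_≡_; _≢_; refl; trans; cong; subst)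

both-true-and-false : ∀ {b : Bool} → b ≡ true → b ≡ false → ⊥
both-true-and-false refl ()

decided-by : ∀ {A : Set} (a? : Dec A) {b : Bool} → b ≡ does a? → (b ≡ true → A) × (A → b ≡ true)
decided-by (yes a) refl = (λ _ → a) , (λ _ → refl)
decided-by (no ¬a) refl = (λ ()) , (λ a → ⊥-elim (¬a a))

Induces : ∀ {k m} → (Fin k → Fin k → Bool) → (Fin m → Fin m → Bool) → (Fin k → Fin m) → Set
Induces H K e = (∀ i j → e i ≡ e j → i ≡ j) × (∀ i j → K (e i) (e j) ≡ H i j)

induces? : ∀ {k m} (H : Fin k → Fin k → Bool) (K : Fin m → Fin m → Bool) (e : Fin k → Fin m) →
           Dec (Induces H K e)
induces? H K e = all? (λ i → all? λ j → e i ≟ e j →-dec i ≟ j)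
           ×-dec all? (λ i → all? λ j → K (e i) (e j) ≟ᵇ H i j)

copy-trans : ∀ {k m} {H : Fin k → Fin k → Bool} {K : Fin m → Fin m → Bool} {e : Fin k → Fin m} {G : Graph} →
             Induces H K e → InducedCopy K G → InducedCopy H G
copy-trans {e = e} (e-injective , e-edges) κ = record
  { f     = f κ ∘ e
  ; inj   = λ {i} {j} eq → e-injective i j (inj κ eq)
  ; edges = λ i j → trans (edges κ (e i) (e j)) (e-edges i j)
  }

no-isolated-vertex : ∀ a → ∃[ b ] adjW a b ≡ true
no-isolated-vertex = from-yes (all? λ a → any? λ b → adjW a b ≟ᵇ true)

one-of₃? : (a b c : ℕ) (r : Fin 5) → Dec (r ≡ a mod 5 ⊎ r ≡ b mod 5 ⊎ r ≡ c mod 5)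
one-of₃? a b c r = r ≟ a mod 5 ⊎-dec r ≟ b mod 5 ⊎-dec r ≟ c mod 5

one-of₄? : (a b c d : ℕ) (r : Fin 5) → Dec (r ≡ a mod 5 ⊎ r ≡ b mod 5 ⊎ r ≡ c mod 5 ⊎ r ≡ d mod 5)
one-of₄? a b c d r = r ≟ a mod 5 ⊎-dec r ≟ b mod 5 ⊎-dec r ≟ c mod 5 ⊎-dec r ≟ d mod 5

-- Entry i is the adjacency of u to position i of Σ: v_i for i < 5, and x for i = 5.
Profile : Set
Profile = Vec Bool 6

-- Σ together with u and a vertex s adjacent to u only; in adjW⁸ they are positions 6 and 7.
adjW⁺ : Profile → Fin 6 ⊎ Fin 2 → Fin 6 ⊎ Fin 2 → Bool
adjW⁺ p (inj₁ a)          (inj₁ b)          = adjW a b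
adjW⁺ p (inj₁ a)          (inj₂ zero)       = lookup p a
adjW⁺ p (inj₂ zero)       (inj₁ b)          = lookup p b
adjW⁺ p (inj₂ zero)       (inj₂ (suc zero)) = true
adjW⁺ p (inj₂ (suc zero)) (inj₂ zero)       = true
adjW⁺ p _                 _                 = false

adjW⁸ : Profile → Fin 8 → Fin 8 → Bool
adjW⁸ p i j = adjW⁺ p (splitAt 6 i) (splitAt 6 j)

module Extension (G : Graph) (σ : InducedCopy adjW G) (u : Fin (n G)) where
  open Wheel G σ

  profile : Profile
  profile = tabulate (adj G u ∘ f σ)

  adj-profile : ∀ {p} → profile ≡ p → ∀ a → adj G u (f σ a) ≡ lookup p a
  adj-profile eq a = trans (≡.sym (lookup∘tabulate (adj G u ∘ f σ) a)) (cong (λ q → lookup q a) eq)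

  cycle-neighbourhood : ∀ {p} → profile ≡ p → {M : Fin 5 → Set} (M? : ∀ r → Dec (M r)) →
                        {True (all? λ r → lookup p (inject₁ r) ≟ᵇ does (M? r))} →
                        ∀ k → (u ~ v k → M (k mod 5)) × (M (k mod 5) → u ~ v k)
  cycle-neighbourhood eq M? {agree} k =
    decided-by (M? (k mod 5)) (trans (adj-profile eq _) (toWitness agree (k mod 5)))

  module _ (s : V) (s∈S : S s) (u~s : u ~ s) where

    s≁Σ : ∀ a → s ≁ f σ a
    s≁Σ zero                                = proj₂ s∈S 0
    s≁Σ (suc zero)                          = proj₂ s∈S 1
    s≁Σ (suc (suc zero))                    = proj₂ s∈S 2
    s≁Σ (suc (suc (suc zero)))              = proj₂ s∈S 3
    s≁Σ (suc (suc (suc (suc zero))))        = proj₂ s∈S 4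
    s≁Σ (suc (suc (suc (suc (suc zero))))) = proj₁ s∈S

    s~u : s ~ u
    s~u = trans (Graph.sym G s u) u~s

    Σ≢u : ∀ a → f σ a ≢ u
    Σ≢u a eq = both-true-and-false (subst (s ~_) (≡.sym eq) s~u) (s≁Σ a)

    Σ≢s : ∀ a → f σ a ≢ s
    Σ≢s a eq with no-isolated-vertex a
    ... | b , a~b = both-true-and-false (subst (_~ f σ b) eq (trans (edges σ a b) a~b)) (s≁Σ b)

    u≢s : u ≢ s
    u≢s eq = both-true-and-false (subst (_~ s) eq u~s) (irrefl G s)

    place : Fin 6 ⊎ Fin 2 → V
    place (inj₁ a)          = f σ a
    place (inj₂ zero)       = u
    place (inj₂ (suc zero)) = s

    place-injective : ∀ a b → place a ≡ place b → a ≡ b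
    place-injective (inj₁ a)          (inj₁ b)          eq = cong inj₁ (inj σ eq)
    place-injective (inj₁ a)          (inj₂ zero)       eq = ⊥-elim (Σ≢u a eq)
    place-injective (inj₁ a)          (inj₂ (suc zero)) eq = ⊥-elim (Σ≢s a eq)
    place-injective (inj₂ zero)       (inj₁ b)          eq = ⊥-elim (Σ≢u b (≡.sym eq))
    place-injective (inj₂ (suc zero)) (inj₁ b)          eq = ⊥-elim (Σ≢s b (≡.sym eq))
    place-injective (inj₂ zero)       (inj₂ zero)       eq = refl
    place-injective (inj₂ zero)       (inj₂ (suc zero)) eq = ⊥-elim (u≢s eq)
    place-injective (inj₂ (suc zero)) (inj₂ zero)       eq = ⊥-elim (u≢s (≡.sym eq))
    place-injective (inj₂ (suc zero)) (inj₂ (suc zero)) eq = refl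

    place-edges : ∀ a b → adj G (place a) (place b) ≡ adjW⁺ profile a b
    place-edges (inj₁ a)          (inj₁ b)          = edges σ a b
    place-edges (inj₁ a)          (inj₂ zero)       = trans (Graph.sym G (f σ a) u) (adj-profile refl a)
    place-edges (inj₁ a)          (inj₂ (suc zero)) = trans (Graph.sym G (f σ a) s) (s≁Σ a)
    place-edges (inj₂ zero)       (inj₁ b)          = adj-profile refl b
    place-edges (inj₂ (suc zero)) (inj₁ b)          = s≁Σ b
    place-edges (inj₂ zero)       (inj₂ zero)       = irrefl G u
    place-edges (inj₂ zero)       (inj₂ (suc zero)) = u~s
    place-edges (inj₂ (suc zero)) (inj₂ zero)       = s~u
    place-edges (inj₂ (suc zero)) (inj₂ (suc zero)) = irrefl G s

    extension : InducedCopy (adjW⁸ profile) G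
    extension = record
      { f     = place ∘ splitAt 6
      ; inj   = λ {i} {j} eq →
                  trans (≡.sym (join-splitAt 6 2 i))
                        (trans (cong (join 6 2) (place-injective (splitAt 6 i) (splitAt 6 j) eq)) (join-splitAt 6 2 j))
      ; edges = λ i j → place-edges (splitAt 6 i) (splitAt 6 j)
      }

data Verdict : Profile → Set where
  in-S    : Verdict (replicate 6 false)
  in-Y₂   : Verdict (true  ∷ false ∷ true  ∷ false ∷ true  ∷ false ∷ [])
  in-Y₅   : Verdict (true  ∷ false ∷ true  ∷ true  ∷ false ∷ false ∷ [])
  in-Y₁ˣ  : Verdict (false ∷ true  ∷ false ∷ true  ∷ true  ∷ true  ∷ [])
  in-P³   : Verdict (true  ∷ false ∷ true  ∷ true  ∷ true  ∷ false ∷ [])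
  in-P³ˣ  : Verdict (true  ∷ false ∷ true  ∷ true  ∷ true  ∷ true  ∷ [])
  in-T    : Verdict (true  ∷ true  ∷ true  ∷ true  ∷ true  ∷ false ∷ [])
  P5-at   : ∀ {p} (e : Vec (Fin 8) 5) → {True (induces? adjP5 (adjW⁸ p) (lookup e))} → Verdict p
  HVN-at  : ∀ {p} (e : Vec (Fin 8) 5) → {True (induces? adjHVN (adjW⁸ p) (lookup e))} → Verdict p

verdict : ∀ p → Verdict p
verdict (false ∷ false ∷ false ∷ false ∷ false ∷ false ∷ []) = in-S
verdict (false ∷ false ∷ false ∷ false ∷ false ∷ true  ∷ []) = P5-at  (# 3 ∷ # 2 ∷ # 5 ∷ # 6 ∷ # 7 ∷ [])
verdict (false ∷ false ∷ false ∷ false ∷ true  ∷ _     ∷ []) = P5-at  (# 1 ∷ # 0 ∷ # 4 ∷ # 6 ∷ # 7 ∷ [])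
verdict (false ∷ false ∷ false ∷ true  ∷ _     ∷ _     ∷ []) = P5-at  (# 0 ∷ # 1 ∷ # 2 ∷ # 3 ∷ # 6 ∷ [])
verdict (false ∷ false ∷ true  ∷ _     ∷ _     ∷ _     ∷ []) = P5-at  (# 0 ∷ # 1 ∷ # 2 ∷ # 6 ∷ # 7 ∷ [])
verdict (false ∷ true  ∷ _     ∷ _     ∷ false ∷ _     ∷ []) = P5-at  (# 4 ∷ # 0 ∷ # 1 ∷ # 6 ∷ # 7 ∷ [])
verdict (false ∷ true  ∷ _     ∷ _     ∷ true  ∷ false ∷ []) = P5-at  (# 5 ∷ # 0 ∷ # 4 ∷ # 6 ∷ # 7 ∷ [])
verdict (false ∷ true  ∷ false ∷ false ∷ true  ∷ true  ∷ []) = P5-at  (# 3 ∷ # 2 ∷ # 5 ∷ # 6 ∷ # 7 ∷ [])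
verdict (false ∷ true  ∷ false ∷ true  ∷ true  ∷ true  ∷ []) = in-Y₁ˣ
verdict (false ∷ true  ∷ true  ∷ _     ∷ true  ∷ true  ∷ []) = HVN-at (# 1 ∷ # 5 ∷ # 2 ∷ # 6 ∷ # 0 ∷ [])
verdict (true  ∷ false ∷ false ∷ _     ∷ _     ∷ _     ∷ []) = P5-at  (# 2 ∷ # 1 ∷ # 0 ∷ # 6 ∷ # 7 ∷ [])
verdict (true  ∷ true  ∷ false ∷ _     ∷ _     ∷ false ∷ []) = P5-at  (# 2 ∷ # 5 ∷ # 0 ∷ # 6 ∷ # 7 ∷ [])
verdict (true  ∷ true  ∷ false ∷ _     ∷ _     ∷ true  ∷ []) = HVN-at (# 1 ∷ # 5 ∷ # 0 ∷ # 6 ∷ # 2 ∷ [])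
verdict (true  ∷ _     ∷ true  ∷ false ∷ false ∷ _     ∷ []) = P5-at  (# 4 ∷ # 3 ∷ # 2 ∷ # 6 ∷ # 7 ∷ [])
verdict (true  ∷ false ∷ true  ∷ false ∷ true  ∷ false ∷ []) = in-Y₂
verdict (true  ∷ false ∷ true  ∷ false ∷ true  ∷ true  ∷ []) = P5-at  (# 1 ∷ # 5 ∷ # 6 ∷ # 4 ∷ # 3 ∷ [])
verdict (true  ∷ true  ∷ true  ∷ false ∷ true  ∷ false ∷ []) = P5-at  (# 3 ∷ # 4 ∷ # 6 ∷ # 1 ∷ # 5 ∷ [])
verdict (true  ∷ true  ∷ true  ∷ false ∷ true  ∷ true  ∷ []) = HVN-at (# 0 ∷ # 6 ∷ # 1 ∷ # 5 ∷ # 4 ∷ [])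
verdict (true  ∷ false ∷ true  ∷ true  ∷ false ∷ false ∷ []) = in-Y₅
verdict (true  ∷ false ∷ true  ∷ true  ∷ false ∷ true  ∷ []) = P5-at  (# 1 ∷ # 5 ∷ # 6 ∷ # 3 ∷ # 4 ∷ [])
verdict (true  ∷ false ∷ true  ∷ true  ∷ true  ∷ false ∷ []) = in-P³
verdict (true  ∷ false ∷ true  ∷ true  ∷ true  ∷ true  ∷ []) = in-P³ˣ
verdict (true  ∷ true  ∷ true  ∷ true  ∷ false ∷ false ∷ []) = P5-at  (# 4 ∷ # 3 ∷ # 6 ∷ # 1 ∷ # 5 ∷ [])
verdict (true  ∷ true  ∷ true  ∷ true  ∷ true  ∷ false ∷ []) = in-T
verdict (true  ∷ true  ∷ true  ∷ true  ∷ _     ∷ true  ∷ []) = HVN-at (# 2 ∷ # 6 ∷ # 1 ∷ # 5 ∷ # 3 ∷ [])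

corollary3p5 : (G : Graph) → Free adjP5 G → Free adjHVN G → (σ : InducedCopy adjW G) →
    let open Wheel G σ in
    (u : V) → ¬ S u → (∃[ s ] (S s × (u ~ s))) →
    Y 2 u ⊎ Y 5 u ⊎ Yx 1 u ⊎ P 3 u ⊎ Px 3 u ⊎ T u
corollary3p5 G P5-free HVN-free σ u u∉S (s , s∈S , u~s) = classify refl (verdict profile)
  where
  open Wheel G σ
  open Extension G σ u

  classify : ∀ {p} → profile ≡ p → Verdict p → Y 2 u ⊎ Y 5 u ⊎ Yx 1 u ⊎ P 3 u ⊎ Px 3 u ⊎ T u
  classify eq in-S   = ⊥-elim (u∉S (adj-profile eq _ , λ k → trans (adj-profile eq _) (lookup-replicate (inject₁ (k mod 5)) false)))
  classify eq in-Y₂  = inj₁ (adj-profile eq _ , cycle-neighbourhood eq (one-of₃? 5 2 4))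
  classify eq in-Y₅  = inj₂ (inj₁ (adj-profile eq _ , cycle-neighbourhood eq (one-of₃? 8 5 7)))
  classify eq in-Y₁ˣ = inj₂ (inj₂ (inj₁ (adj-profile eq _ , cycle-neighbourhood eq (one-of₃? 4 1 3))))
  classify eq in-P³  = inj₂ (inj₂ (inj₂ (inj₁ (adj-profile eq _ , cycle-neighbourhood eq (one-of₄? 7 3 4 5)))))
  classify eq in-P³ˣ = inj₂ (inj₂ (inj₂ (inj₂ (inj₁ (adj-profile eq _ , cycle-neighbourhood eq (one-of₄? 7 3 4 5))))))
  classify eq in-T   = inj₂ (inj₂ (inj₂ (inj₂ (inj₂
                         (adj-profile eq _ , λ k → proj₂ (cycle-neighbourhood eq (λ _ → yes tt) k) tt)))))
  classify refl (P5-at  e {e-induces}) = ⊥-elim (P5-free  (copy-trans (toWitness e-induces) (extension s s∈S u~s)))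
  classify refl (HVN-at e {e-induces}) = ⊥-elim (HVN-free (copy-trans (toWitness e-induces) (extension s s∈S u~s)))
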